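{- For every integer $n\ge1$: 1. For $0\le k,i\le n$, $K_k^{(n)}(0)\ge|K_k^{(n)}(i)|$. 2. For $0\le k\le\frac{n-1}{2}$ and $1\le i\le n-1$, $K_k^{(n)}(1)\ge|K_k^{(n)}(i)|$. 3. For $0\le k\le\tau(n)$ and $2\le i\le n-2$, $K_k^{(n)}(2)\ge|K_k^{(n)}(i)|$, where $\tau(n)=\frac12\big(\frac n2+2-\sqrt{\frac n2+2}\big)$.
   Context: The Krawtchouk polynomials are $K_k^{(n)}(x)=\sum_{j=0}^k(-1)^j\binom xj\binom{n-x}{k-j}$, where for real $x$ and integer $j$, $\binom xj=\frac{x(x-1)\cdots(x-j+1)}{j!}$ for $j>0$, $\binom x0=1$, and $\binom xj=0$ for $j<0$. -}

module Defs where

open import Data.Nat using (ℕ; zero; suc; _∸_)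
open import Data.Nat.Combinatorics using (_C_)
open import Data.Integer using (ℤ; +_; -_; _+_; _*_)

sgn : ℕ → ℤ
sgn zero = + 1
sgn (suc j) = - sgn j

sumTo : ℕ → (ℕ → ℤ) → ℤ
sumTo zero f = f 0
sumTo (suc k) f = sumTo k f + f (suc k)

-- For natural x ≤ n the generalized binomials coincide with the ordinary ones
-- (C(x,j) = 0 for j > x), and k - j ≥ 0 in the range of summation.
K : ℕ → ℕ → ℕ → ℤ
K n k x = sumTo k (λ j → sgn j * (+ ((x C j) Data.Nat.* ((n ∸ x) C (k ∸ j)))))

module Submission where

-- K_k^(n)(i) = G(i, n − i, k), where G(x, y, k) = kraw x y k is the coefficient of t^k in (1 − t)^x (1 + t)^y.
-- Differentiating gives (k + 1) G(x, y, k + 1) = −x G(x − 1, y, k) + y G(x, y − 1, k), so by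
-- induction on k, |G(x, y, k)| ≤ C(x + y, k) = K_k(0). Together with the contiguous relation it gives
--   (k + 1)(x + y − k − 1) G(x, y, k + 1) = y(y − 1) G(x, y − 2, k) − x(x − 1) G(x − 2, y, k).
-- The closed forms n G(1, n − 1, k) = (n − 2k) C(n, k) and n(n − 1) G(2, n − 2, k) = ((n − 2k)² − n) C(n, k)
-- are nonnegative under the hypotheses, so at x = 1, 2 this recurrence is an identity between absolute
-- values. Induction on k, assuming x ≤ y by the symmetry G(y, x, k) = ±G(x, y, k), then bounds
-- |G(x, y, k + 1)| through the triangle inequality, since X(X − 1) + Y(Y − 1) ≤ N(N − 1) for the
-- coefficients involved; for x = 2 the extra term 2 C(n − 2, k) is absorbed using k ≤ τ(n).

open import Defs
open import Data.Nat as ℕ using (ℕ; zero; suc; pred; _∸_; z≤n; s≤s)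
import Data.Nat.Properties as ℕₚ
open import Data.Nat.Combinatorics using (_C_; nCk+nC[k+1]≡[n+1]C[k+1])
open import Data.Integer as ℤ using (ℤ; +_; -_; -[1+_]; ∣_∣)
import Data.Integer.Properties as ℤₚ
open import Data.Product using (_×_; _,_; proj₁; proj₂; ∃)
open import Data.Sum using (inj₁; inj₂)
open import Relation.Binary.PropositionalEquality using (_≡_; refl; sym; trans; cong; cong₂; subst; module ≡-Reasoning)
open import Relation.Nullary using (yes; no; contradiction)
import Data.Nat.Tactic.RingSolver as ℕ-Solver
import Data.Integer.Tactic.RingSolver as ℤ-Solver

module _ where
  open import Data.Nat using (_+_; _*_)
  open ≡-Reasoning

  -- Pascal's rule; unlike _C_, which divides factorials, it computes on open terms
  binomial : ℕ → ℕ → ℕ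
  binomial n       zero    = 1
  binomial zero    (suc k) = 0
  binomial (suc n) (suc k) = binomial n k + binomial n (suc k)

  binomial≡C : ∀ n k → binomial n k ≡ n C k
  binomial≡C zero    zero    = refl
  binomial≡C zero    (suc k) = refl
  binomial≡C (suc n) zero    = refl
  binomial≡C (suc n) (suc k) =
    trans (cong₂ _+_ (binomial≡C n k) (binomial≡C n (suc k))) (nCk+nC[k+1]≡[n+1]C[k+1] n k)

  binomial[n,1]≡n : ∀ n → binomial n 1 ≡ n
  binomial[n,1]≡n zero    = refl
  binomial[n,1]≡n (suc n) = cong suc (binomial[n,1]≡n n)

  binomial-absorption : ∀ n j → suc j * binomial (suc n) (suc j) ≡ suc n * binomial n j
  binomial-absorption zero    zero    = refl
  binomial-absorption zero    (suc j) = ℕₚ.*-zeroʳ (suc (suc j))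
  binomial-absorption (suc n) zero    =
    trans (ℕₚ.+-identityʳ _) (trans (binomial[n,1]≡n (suc (suc n))) (sym (ℕₚ.*-identityʳ (suc (suc n)))))
  binomial-absorption (suc n) (suc j) = begin
    suc (suc j) * (b₁ + b₂)
      ≡⟨ expand (suc j) b₁ b₂ ⟩
    b₁ + suc j * b₁ + suc (suc j) * b₂
      ≡⟨ cong₂ (λ u v → b₁ + u + v) (binomial-absorption n j) (binomial-absorption n (suc j)) ⟩
    b₁ + suc n * binomial n j + suc n * binomial n (suc j)
      ≡⟨ collect (suc n) (binomial n j) (binomial n (suc j)) ⟩
    suc (suc n) * (binomial n j + binomial n (suc j)) ∎
    where
    b₁ b₂ : ℕ
    b₁ = binomial (suc n) (suc j)
    b₂ = binomial (suc n) (suc (suc j))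
    expand : ∀ a b c → suc a * (b + c) ≡ b + a * b + suc a * c
    expand = ℕ-Solver.solve-∀
    collect : ∀ a b c → (b + c) + a * b + a * c ≡ suc a * (b + c)
    collect = ℕ-Solver.solve-∀

  binomial-absorption′ : ∀ x j → suc j * binomial x (suc j) ≡ x * binomial (pred x) j
  binomial-absorption′ zero    j = ℕₚ.*-zeroʳ (suc j)
  binomial-absorption′ (suc x) j = binomial-absorption x j

  binomial-complement-absorption : ∀ x j → x * binomial x j ≡ j * binomial x j + x * binomial (pred x) j
  binomial-complement-absorption zero    zero    = refl
  binomial-complement-absorption zero    (suc j) = sym (trans (ℕₚ.+-identityʳ _) (ℕₚ.*-zeroʳ (suc j)))
  binomial-complement-absorption (suc x) zero    = refl
  binomial-complement-absorption (suc x) (suc j) = begin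
    suc x * (binomial x j + binomial x (suc j))
      ≡⟨ ℕₚ.*-distribˡ-+ (suc x) (binomial x j) (binomial x (suc j)) ⟩
    suc x * binomial x j + suc x * binomial x (suc j)
      ≡⟨ cong (_+ suc x * binomial x (suc j)) (sym (binomial-absorption x j)) ⟩
    suc j * binomial (suc x) (suc j) + suc x * binomial x (suc j) ∎

  -- (n − 2k)² − n for n = u + 4k, as a polynomial free of truncated subtraction
  Δ : ℕ → ℕ → ℕ
  Δ u k = u * pred u + 4 * u * k + 4 * k * pred k

  Δ+n≡m² : ∀ u k → Δ u k + (u + 4 * k) ≡ (u + 2 * k) * (u + 2 * k)
  Δ+n≡m² zero    zero    = refl
  Δ+n≡m² zero    (suc k) = expand k
    where
    expand : ∀ k → 0 * 0 + 4 * 0 * suc k + 4 * suc k * k + (0 + 4 * suc k) ≡ (0 + 2 * suc k) * (0 + 2 * suc k)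
    expand = ℕ-Solver.solve-∀
  Δ+n≡m² (suc u) zero    = expand u
    where
    expand : ∀ u → suc u * u + 4 * suc u * 0 + 4 * 0 * 0 + (suc u + 4 * 0) ≡ (suc u + 2 * 0) * (suc u + 2 * 0)
    expand = ℕ-Solver.solve-∀
  Δ+n≡m² (suc u) (suc k) = expand u k
    where
    expand : ∀ u k → suc u * u + 4 * suc u * suc k + 4 * suc k * k + (suc u + 4 * suc k)
             ≡ (suc u + 2 * suc k) * (suc u + 2 * suc k)
    expand = ℕ-Solver.solve-∀

  m+[1+k+1+k]≡2+n⇒m+[k+k]≡n : ∀ m k n → m + (suc k + suc k) ≡ suc (suc n) → m + (k + k) ≡ n
  m+[1+k+1+k]≡2+n⇒m+[k+k]≡n m k n e = ℕₚ.suc-injective (ℕₚ.suc-injective (trans (sym (regroup m k)) e))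
    where
    regroup : ∀ m k → m + (suc k + suc k) ≡ suc (suc (m + (k + k)))
    regroup = ℕ-Solver.solve-∀

  2+n≡u+4[1+k]⇒n≡2+u+4k : ∀ u k n → suc (suc n) ≡ u + 4 * suc k → n ≡ suc (suc u) + 4 * k
  2+n≡u+4[1+k]⇒n≡2+u+4k u k n e = ℕₚ.suc-injective (ℕₚ.suc-injective (trans e (regroup u k)))
    where
    regroup : ∀ u k → u + 4 * suc k ≡ suc (suc (suc (suc u) + 4 * k))
    regroup = ℕ-Solver.solve-∀

module _ where
  open import Data.Integer using (_+_; _*_; _-_)
  open ≡-Reasoning

  sumTo-cong : ∀ k {f g : ℕ → ℤ} → (∀ j → j ℕ.≤ k → f j ≡ g j) → sumTo k f ≡ sumTo k g
  sumTo-cong zero    f≗g = f≗g 0 z≤n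
  sumTo-cong (suc k) f≗g =
    cong₂ _+_ (sumTo-cong k (λ j j≤k → f≗g j (ℕₚ.m≤n⇒m≤1+n j≤k))) (f≗g (suc k) ℕₚ.≤-refl)

  sumTo-+ : ∀ k (f g : ℕ → ℤ) → sumTo k (λ j → f j + g j) ≡ sumTo k f + sumTo k g
  sumTo-+ zero    f g = refl
  sumTo-+ (suc k) f g =
    trans (cong (_+ (f (suc k) + g (suc k))) (sumTo-+ k f g)) (interchange (sumTo k f) (sumTo k g) (f (suc k)) (g (suc k)))
    where
    interchange : ∀ a b c d → a + b + (c + d) ≡ a + c + (b + d)
    interchange = ℤ-Solver.solve-∀

  sumTo-*ˡ : ∀ k c (f : ℕ → ℤ) → sumTo k (λ j → c * f j) ≡ c * sumTo k f
  sumTo-*ˡ zero    c f = refl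
  sumTo-*ˡ (suc k) c f =
    trans (cong (_+ c * f (suc k)) (sumTo-*ˡ k c f)) (sym (ℤₚ.*-distribˡ-+ c (sumTo k f) (f (suc k))))

  sumTo-suc : ∀ k (f : ℕ → ℤ) → sumTo (suc k) f ≡ f 0 + sumTo k (λ j → f (suc j))
  sumTo-suc zero    f = refl
  sumTo-suc (suc k) f = trans (cong (_+ f (suc (suc k))) (sumTo-suc k f)) (ℤₚ.+-assoc (f 0) _ _)

  sumTo-head : ∀ k (f : ℕ → ℤ) → (∀ j → f (suc j) ≡ + 0) → sumTo k f ≡ f 0
  sumTo-head zero    f tail≡0 = refl
  sumTo-head (suc k) f tail≡0 = trans (cong₂ _+_ (sumTo-head k f tail≡0) (tail≡0 k)) (ℤₚ.+-identityʳ (f 0))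

  kraw-term : ℕ → ℕ → ℕ → ℕ → ℤ
  kraw-term x y k j = sgn j * (+ binomial x j * + binomial y (k ∸ j))

  kraw : ℕ → ℕ → ℕ → ℤ
  kraw x y k = sumTo k (kraw-term x y k)

  K≡kraw : ∀ n k i → K n k i ≡ kraw i (n ∸ i) k
  K≡kraw n k i = sumTo-cong k (λ j _ → cong (sgn j *_) (begin
    + ((i C j) ℕ.* ((n ∸ i) C (k ∸ j)))
      ≡⟨ cong +_ (sym (cong₂ ℕ._*_ (binomial≡C i j) (binomial≡C (n ∸ i) (k ∸ j)))) ⟩
    + (binomial i j ℕ.* binomial (n ∸ i) (k ∸ j))
      ≡⟨ ℤₚ.pos-* (binomial i j) (binomial (n ∸ i) (k ∸ j)) ⟩
    + binomial i j * + binomial (n ∸ i) (k ∸ j) ∎))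

  K≡kraw-complement : ∀ i y k → K (i ℕ.+ y) k i ≡ kraw i y k
  K≡kraw-complement i y k = trans (K≡kraw (i ℕ.+ y) k i) (cong (λ z → kraw i z k) (ℕₚ.m+n∸m≡n i y))

  kraw-zeroˡ : ∀ y k → kraw 0 y k ≡ + binomial y k
  kraw-zeroˡ y k = begin
    kraw 0 y k                   ≡⟨ sumTo-head k _ (λ j → ℤₚ.*-zeroʳ (sgn (suc j))) ⟩
    + 1 * (+ 1 * + binomial y k) ≡⟨ ℤₚ.*-identityˡ _ ⟩
    + 1 * + binomial y k         ≡⟨ ℤₚ.*-identityˡ _ ⟩
    + binomial y k               ∎

  kraw-term-contiguous : ∀ x y k j → j ℕ.≤ k →
    (+ x + + y - + k) * kraw-term x y k j ≡ + x * kraw-term (pred x) y k j + + y * kraw-term x (pred y) k j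
  kraw-term-contiguous x y k j j≤k = begin
    (X + Y - + k) * (s * (b₁ * b₂))
      ≡⟨ cong (λ m → (X + Y - m) * (s * (b₁ * b₂))) (trans (cong +_ (sym (ℕₚ.m+[n∸m]≡n j≤k))) (ℤₚ.pos-+ j (k ∸ j))) ⟩
    (X + Y - (J + R)) * (s * (b₁ * b₂))
      ≡⟨ distribute X Y J R s b₁ b₂ ⟩
    s * b₂ * (X * b₁) + s * b₁ * (Y * b₂) - s * b₁ * b₂ * J - s * b₁ * b₂ * R
      ≡⟨ cong₂ (λ u v → s * b₂ * u + s * b₁ * v - s * b₁ * b₂ * J - s * b₁ * b₂ * R)
               (complement x j) (complement y (k ∸ j)) ⟩
    s * b₂ * (J * b₁ + X * c₁) + s * b₁ * (R * b₂ + Y * c₂) - s * b₁ * b₂ * J - s * b₁ * b₂ * R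
      ≡⟨ cancel X Y J R s b₁ c₁ b₂ c₂ ⟩
    X * (s * (c₁ * b₂)) + Y * (s * (b₁ * c₂)) ∎
    where
    X Y J R s b₁ b₂ c₁ c₂ : ℤ
    X = + x
    Y = + y
    J = + j
    R = + (k ∸ j)
    s = sgn j
    b₁ = + binomial x j
    b₂ = + binomial y (k ∸ j)
    c₁ = + binomial (pred x) j
    c₂ = + binomial (pred y) (k ∸ j)
    complement : ∀ x j → + x * + binomial x j ≡ + j * + binomial x j + + x * + binomial (pred x) j
    complement x j = begin
      + x * + binomial x j                                    ≡⟨ sym (ℤₚ.pos-* x _) ⟩
      + (x ℕ.* binomial x j)                                  ≡⟨ cong +_ (binomial-complement-absorption x j) ⟩
      + (j ℕ.* binomial x j ℕ.+ x ℕ.* binomial (pred x) j)    ≡⟨ ℤₚ.pos-+ (j ℕ.* binomial x j) (x ℕ.* binomial (pred x) j) ⟩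
      + (j ℕ.* binomial x j) + + (x ℕ.* binomial (pred x) j)  ≡⟨ cong₂ _+_ (ℤₚ.pos-* j _) (ℤₚ.pos-* x _) ⟩
      + j * + binomial x j + + x * + binomial (pred x) j      ∎
    distribute : ∀ X Y J R s b₁ b₂ → (X + Y - (J + R)) * (s * (b₁ * b₂))
                 ≡ s * b₂ * (X * b₁) + s * b₁ * (Y * b₂) - s * b₁ * b₂ * J - s * b₁ * b₂ * R
    distribute = ℤ-Solver.solve-∀
    cancel : ∀ X Y J R s b₁ c₁ b₂ c₂ →
             s * b₂ * (J * b₁ + X * c₁) + s * b₁ * (R * b₂ + Y * c₂) - s * b₁ * b₂ * J - s * b₁ * b₂ * R
             ≡ X * (s * (c₁ * b₂)) + Y * (s * (b₁ * c₂))
    cancel = ℤ-Solver.solve-∀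

  kraw-contiguous : ∀ x y k → (+ x + + y - + k) * kraw x y k ≡ + x * kraw (pred x) y k + + y * kraw x (pred y) k
  kraw-contiguous x y k = begin
    (+ x + + y - + k) * kraw x y k
      ≡⟨ sym (sumTo-*ˡ k (+ x + + y - + k) (kraw-term x y k)) ⟩
    sumTo k (λ j → (+ x + + y - + k) * kraw-term x y k j)
      ≡⟨ sumTo-cong k (kraw-term-contiguous x y k) ⟩
    sumTo k (λ j → + x * kraw-term (pred x) y k j + + y * kraw-term x (pred y) k j)
      ≡⟨ sumTo-+ k (λ j → + x * kraw-term (pred x) y k j) (λ j → + y * kraw-term x (pred y) k j) ⟩
    sumTo k (λ j → + x * kraw-term (pred x) y k j) + sumTo k (λ j → + y * kraw-term x (pred y) k j)
      ≡⟨ cong₂ _+_ (sumTo-*ˡ k (+ x) (kraw-term (pred x) y k)) (sumTo-*ˡ k (+ y) (kraw-term x (pred y) k)) ⟩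
    + x * kraw (pred x) y k + + y * kraw x (pred y) k ∎

  pos-absorption : ∀ x j → + suc j * + binomial x (suc j) ≡ + x * + binomial (pred x) j
  pos-absorption x j = begin
    + suc j * + binomial x (suc j)     ≡⟨ sym (ℤₚ.pos-* (suc j) (binomial x (suc j))) ⟩
    + (suc j ℕ.* binomial x (suc j))   ≡⟨ cong +_ (binomial-absorption′ x j) ⟩
    + (x ℕ.* binomial (pred x) j)      ≡⟨ ℤₚ.pos-* x (binomial (pred x) j) ⟩
    + x * + binomial (pred x) j        ∎

  kraw-index-weighted : ∀ x y k → sumTo (suc k) (λ j → + j * kraw-term x y (suc k) j) ≡ - (+ x * kraw (pred x) y k)
  kraw-index-weighted x y k = begin
    sumTo (suc k) (λ j → + j * kraw-term x y (suc k) j)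
      ≡⟨ sumTo-suc k (λ j → + j * kraw-term x y (suc k) j) ⟩
    + 0 + sumTo k (λ j → + suc j * kraw-term x y (suc k) (suc j))
      ≡⟨ ℤₚ.+-identityˡ _ ⟩
    sumTo k (λ j → + suc j * kraw-term x y (suc k) (suc j))
      ≡⟨ sumTo-cong k (λ j _ → rearrange (+ suc j) _ (+ binomial y (k ∸ j)) (+ x) _ (sgn j) (pos-absorption x j)) ⟩
    sumTo k (λ j → - + x * kraw-term (pred x) y k j)
      ≡⟨ sumTo-*ˡ k (- + x) (kraw-term (pred x) y k) ⟩
    - + x * kraw (pred x) y k
      ≡⟨ sym (ℤₚ.neg-distribˡ-* (+ x) _) ⟩
    - (+ x * kraw (pred x) y k) ∎
    where
    rearrange : ∀ a b c x d s → a * b ≡ x * d → a * (- s * (b * c)) ≡ - x * (s * (d * c))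
    rearrange a b c x d s e = begin
      a * (- s * (b * c)) ≡⟨ pull a b c s ⟩
      - (s * c * (a * b)) ≡⟨ cong (λ u → - (s * c * u)) e ⟩
      - (s * c * (x * d)) ≡⟨ push x d c s ⟩
      - x * (s * (d * c)) ∎
      where
      pull : ∀ a b c s → a * (- s * (b * c)) ≡ - (s * c * (a * b))
      pull = ℤ-Solver.solve-∀
      push : ∀ x d c s → - (s * c * (x * d)) ≡ - x * (s * (d * c))
      push = ℤ-Solver.solve-∀

  kraw-coindex-weighted : ∀ x y k → sumTo (suc k) (λ j → + (suc k ∸ j) * kraw-term x y (suc k) j) ≡ + y * kraw x (pred y) k
  kraw-coindex-weighted x y k = begin
    sumTo k (λ j → + (suc k ∸ j) * t j) + + (k ∸ k) * t (suc k)
      ≡⟨ cong (λ m → sumTo k (λ j → + (suc k ∸ j) * t j) + + m * t (suc k)) (ℕₚ.n∸n≡0 k) ⟩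
    sumTo k (λ j → + (suc k ∸ j) * t j) + + 0
      ≡⟨ ℤₚ.+-identityʳ _ ⟩
    sumTo k (λ j → + (suc k ∸ j) * t j)
      ≡⟨ sumTo-cong k term ⟩
    sumTo k (λ j → + y * kraw-term x (pred y) k j)
      ≡⟨ sumTo-*ˡ k (+ y) (kraw-term x (pred y) k) ⟩
    + y * kraw x (pred y) k ∎
    where
    t : ℕ → ℤ
    t = kraw-term x y (suc k)
    rearrange : ∀ a b c y d s → a * c ≡ y * d → a * (s * (b * c)) ≡ y * (s * (b * d))
    rearrange a b c y d s e = begin
      a * (s * (b * c)) ≡⟨ pull a b c s ⟩
      s * b * (a * c)   ≡⟨ cong (s * b *_) e ⟩
      s * b * (y * d)   ≡⟨ push y b d s ⟩
      y * (s * (b * d)) ∎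
      where
      pull : ∀ a b c s → a * (s * (b * c)) ≡ s * b * (a * c)
      pull = ℤ-Solver.solve-∀
      push : ∀ y b d s → s * b * (y * d) ≡ y * (s * (b * d))
      push = ℤ-Solver.solve-∀
    term : ∀ j → j ℕ.≤ k → + (suc k ∸ j) * t j ≡ + y * kraw-term x (pred y) k j
    term j j≤k rewrite ℕₚ.+-∸-assoc 1 j≤k =
      rearrange (+ suc (k ∸ j)) (+ binomial x j) _ (+ y) _ (sgn j) (pos-absorption y (k ∸ j))

  kraw-derivative : ∀ x y k → + suc k * kraw x y (suc k) ≡ - (+ x * kraw (pred x) y k) + + y * kraw x (pred y) k
  kraw-derivative x y k = begin
    + suc k * kraw x y (suc k)
      ≡⟨ sym (sumTo-*ˡ (suc k) (+ suc k) t) ⟩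
    sumTo (suc k) (λ j → + suc k * t j)
      ≡⟨ sumTo-cong (suc k) split ⟩
    sumTo (suc k) (λ j → + j * t j + + (suc k ∸ j) * t j)
      ≡⟨ sumTo-+ (suc k) (λ j → + j * t j) (λ j → + (suc k ∸ j) * t j) ⟩
    sumTo (suc k) (λ j → + j * t j) + sumTo (suc k) (λ j → + (suc k ∸ j) * t j)
      ≡⟨ cong₂ _+_ (kraw-index-weighted x y k) (kraw-coindex-weighted x y k) ⟩
    - (+ x * kraw (pred x) y k) + + y * kraw x (pred y) k ∎
    where
    t : ℕ → ℤ
    t = kraw-term x y (suc k)
    split : ∀ j → j ℕ.≤ suc k → + suc k * t j ≡ + j * t j + + (suc k ∸ j) * t j
    split j j≤ = begin
      + suc k * t j                   ≡⟨ cong (λ m → + m * t j) (sym (ℕₚ.m+[n∸m]≡n j≤)) ⟩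
      + (j ℕ.+ (suc k ∸ j)) * t j      ≡⟨ cong (_* t j) (ℤₚ.pos-+ j (suc k ∸ j)) ⟩
      (+ j + + (suc k ∸ j)) * t j      ≡⟨ ℤₚ.*-distribʳ-+ (t j) (+ j) (+ (suc k ∸ j)) ⟩
      + j * t j + + (suc k ∸ j) * t j ∎

  kraw-swap : ∀ k x y → kraw y x k ≡ sgn k * kraw x y k
  kraw-swap zero    x y = refl
  kraw-swap (suc k) x y = ℤₚ.*-cancelˡ-≡ (+ suc k) _ _ (begin
    + suc k * kraw y x (suc k)
      ≡⟨ kraw-derivative y x k ⟩
    - (+ y * kraw (pred y) x k) + + x * kraw y (pred x) k
      ≡⟨ cong₂ (λ u v → - (+ y * u) + + x * v) (kraw-swap k x (pred y)) (kraw-swap k (pred x) y) ⟩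
    - (+ y * (sgn k * kraw x (pred y) k)) + + x * (sgn k * kraw (pred x) y k)
      ≡⟨ factor (sgn k) (+ x) (+ y) (kraw (pred x) y k) (kraw x (pred y) k) ⟩
    - sgn k * (- (+ x * kraw (pred x) y k) + + y * kraw x (pred y) k)
      ≡⟨ cong (- sgn k *_) (sym (kraw-derivative x y k)) ⟩
    - sgn k * (+ suc k * kraw x y (suc k))
      ≡⟨ commute (sgn k) (+ suc k) (kraw x y (suc k)) ⟩
    + suc k * (- sgn k * kraw x y (suc k)) ∎)
    where
    factor : ∀ s x y a b → - (y * (s * b)) + x * (s * a) ≡ - s * (- (x * a) + y * b)
    factor = ℤ-Solver.solve-∀
    commute : ∀ s c g → - s * (c * g) ≡ c * (- s * g)
    commute = ℤ-Solver.solve-∀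

  ∣sgn∣≡1 : ∀ k → ∣ sgn k ∣ ≡ 1
  ∣sgn∣≡1 zero    = refl
  ∣sgn∣≡1 (suc k) = trans (ℤₚ.∣-i∣≡∣i∣ (sgn k)) (∣sgn∣≡1 k)

  ∣kraw-swap∣ : ∀ k x y → ∣ kraw y x k ∣ ≡ ∣ kraw x y k ∣
  ∣kraw-swap∣ k x y = begin
    ∣ kraw y x k ∣                    ≡⟨ cong ∣_∣ (kraw-swap k x y) ⟩
    ∣ sgn k * kraw x y k ∣            ≡⟨ ℤₚ.abs-* (sgn k) (kraw x y k) ⟩
    ∣ sgn k ∣ ℕ.* ∣ kraw x y k ∣      ≡⟨ cong (ℕ._* ∣ kraw x y k ∣) (∣sgn∣≡1 k) ⟩
    1 ℕ.* ∣ kraw x y k ∣              ≡⟨ ℕₚ.*-identityˡ _ ⟩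
    ∣ kraw x y k ∣                    ∎

  kraw-two-step : ∀ x y k → + suc k * (+ x + + y - + suc k) * kraw x y (suc k)
                  ≡ + y * + pred y * kraw x (pred (pred y)) k - + x * + pred x * kraw (pred (pred x)) y k
  kraw-two-step x y k = begin
    s * (X + Y - s) * kraw x y (suc k)
      ≡⟨ ℤₚ.*-assoc s (X + Y - s) (kraw x y (suc k)) ⟩
    s * ((X + Y - s) * kraw x y (suc k))
      ≡⟨ cong (s *_) (kraw-contiguous x y (suc k)) ⟩
    s * (X * kraw (pred x) y (suc k) + Y * kraw x (pred y) (suc k))
      ≡⟨ distribute s X Y _ _ ⟩
    X * (s * kraw (pred x) y (suc k)) + Y * (s * kraw x (pred y) (suc k))
      ≡⟨ cong₂ (λ u v → X * u + Y * v) (kraw-derivative (pred x) y k) (kraw-derivative x (pred y) k) ⟩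
    X * (- (+ pred x * kraw (pred (pred x)) y k) + Y * kraw (pred x) (pred y) k)
      + Y * (- (X * kraw (pred x) (pred y) k) + + pred y * kraw x (pred (pred y)) k)
      ≡⟨ cancel X Y (+ pred x) (+ pred y) _ _ _ ⟩
    Y * + pred y * kraw x (pred (pred y)) k - X * + pred x * kraw (pred (pred x)) y k ∎
    where
    s X Y : ℤ
    s = + suc k
    X = + x
    Y = + y
    distribute : ∀ s X Y g₁ g₂ → s * (X * g₁ + Y * g₂) ≡ X * (s * g₁) + Y * (s * g₂)
    distribute = ℤ-Solver.solve-∀
    cancel : ∀ X Y X′ Y′ a c d → X * (- (X′ * a) + Y * c) + Y * (- (X * c) + Y′ * d) ≡ Y * Y′ * d - X * X′ * a
    cancel = ℤ-Solver.solve-∀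

  kraw-zeroʳ : ∀ x k → kraw x 0 k ≡ sgn k * + binomial x k
  kraw-zeroʳ x k = trans (kraw-swap k 0 x) (cong (sgn k *_) (kraw-zeroˡ x k))

  -- The induction steps of the closed forms, with + suc y read as + 1 + + y: stated for variables
  -- constrained by such equations, they are ring identities.
  kraw-1-closed-step : ∀ A V S K g h b b′ → A ≡ + 1 + V → S ≡ + 1 + K →
    S * g ≡ - (+ 1 * b) + V * h → V * h ≡ (V - (K + K)) * b → S * b′ ≡ A * b →
    S * (A * g) ≡ S * ((A - (S + S)) * b′)
  kraw-1-closed-step .(+ 1 + V) V .(+ 1 + K) K g h b b′ refl refl derivative hypothesis absorption = begin
    S * (A * g)                             ≡⟨ swap S A g ⟩
    A * (S * g)                             ≡⟨ cong (A *_) derivative ⟩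
    A * (- (+ 1 * b) + V * h)               ≡⟨ cong (λ u → A * (- (+ 1 * b) + u)) hypothesis ⟩
    A * (- (+ 1 * b) + (V - (K + K)) * b)   ≡⟨ collect K V b ⟩
    (A - (S + S)) * (A * b)                 ≡⟨ cong ((A - (S + S)) *_) (sym absorption) ⟩
    (A - (S + S)) * (S * b′)                ≡⟨ swap (A - (S + S)) S b′ ⟩
    S * ((A - (S + S)) * b′)                ∎
    where
    A S : ℤ
    A = + 1 + V
    S = + 1 + K
    swap : ∀ a b c → a * (b * c) ≡ b * (a * c)
    swap = ℤ-Solver.solve-∀
    collect : ∀ K V b → (+ 1 + V) * (- (+ 1 * b) + (V - (K + K)) * b)
              ≡ ((+ 1 + V) - ((+ 1 + K) + (+ 1 + K))) * ((+ 1 + V) * b)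
    collect = ℤ-Solver.solve-∀

  kraw-1-closed : ∀ k y → + suc y * kraw 1 y k ≡ (+ suc y - (+ k + + k)) * + binomial (suc y) k
  kraw-1-closed zero                y = base (+ suc y)
    where
    base : ∀ a → a * + 1 ≡ (a - (+ 0 + + 0)) * + 1
    base = ℤ-Solver.solve-∀
  kraw-1-closed (suc zero)          zero = refl
  kraw-1-closed (suc (suc k))       zero =
    trans (cong (+ 1 *_) (trans (kraw-zeroʳ 1 (suc (suc k))) (ℤₚ.*-zeroʳ (sgn (suc (suc k))))))
          (sym (ℤₚ.*-zeroʳ (+ 1 - (+ suc (suc k) + + suc (suc k)))))
  kraw-1-closed (suc k)             (suc y) = ℤₚ.*-cancelˡ-≡ (+ suc k) _ _
    (kraw-1-closed-step (+ suc (suc y)) (+ suc y) (+ suc k) (+ k)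
      (kraw 1 (suc y) (suc k)) (kraw 1 y k) (+ binomial (suc y) k) (+ binomial (suc (suc y)) (suc k))
      (ℤₚ.pos-+ 1 (suc y)) (ℤₚ.pos-+ 1 k)
      (trans (kraw-derivative 1 (suc y) k) (cong (λ b → - (+ 1 * b) + + suc y * kraw 1 y k) (kraw-zeroˡ (suc y) k)))
      (kraw-1-closed k y)
      (pos-absorption (suc (suc y)) k))

  kraw-2-closed-step : ∀ A V Y S K g g₁ h b b′ → A ≡ + 1 + V → V ≡ + 1 + Y → S ≡ + 1 + K →
    S * g ≡ - (+ 2 * g₁) + Y * h → V * g₁ ≡ (V - (K + K)) * b →
    V * Y * h ≡ ((V - (K + K)) * (V - (K + K)) - V) * b → S * b′ ≡ A * b →
    S * (A * V * g) ≡ S * (((A - (S + S)) * (A - (S + S)) - A) * b′)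
  kraw-2-closed-step .(+ 1 + (+ 1 + Y)) .(+ 1 + Y) Y .(+ 1 + K) K g g₁ h b b′ refl refl refl derivative closed₁ hypothesis absorption = begin
    S * (A * V * g)                                              ≡⟨ regroup A V S g ⟩
    A * (V * (S * g))                                            ≡⟨ cong (λ u → A * (V * u)) derivative ⟩
    A * (V * (- (+ 2 * g₁) + Y * h))                             ≡⟨ distribute A V Y g₁ h ⟩
    A * (- (+ 2 * (V * g₁)) + V * Y * h)                         ≡⟨ cong₂ (λ u w → A * (- (+ 2 * u) + w)) closed₁ hypothesis ⟩
    A * (- (+ 2 * (D * b)) + (D * D - V) * b)                    ≡⟨ collect K Y b ⟩
    ((A - (S + S)) * (A - (S + S)) - A) * (A * b)                ≡⟨ cong (((A - (S + S)) * (A - (S + S)) - A) *_) (sym absorption) ⟩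
    ((A - (S + S)) * (A - (S + S)) - A) * (S * b′)               ≡⟨ swap ((A - (S + S)) * (A - (S + S)) - A) S b′ ⟩
    S * (((A - (S + S)) * (A - (S + S)) - A) * b′)               ∎
    where
    V A S D : ℤ
    V = + 1 + Y
    A = + 1 + V
    S = + 1 + K
    D = V - (K + K)
    regroup : ∀ A V S g → S * (A * V * g) ≡ A * (V * (S * g))
    regroup = ℤ-Solver.solve-∀
    distribute : ∀ A V Y g₁ h → A * (V * (- (+ 2 * g₁) + Y * h)) ≡ A * (- (+ 2 * (V * g₁)) + V * Y * h)
    distribute = ℤ-Solver.solve-∀
    collect : ∀ K Y b →
      (+ 1 + (+ 1 + Y)) * (- (+ 2 * (((+ 1 + Y) - (K + K)) * b)) + (((+ 1 + Y) - (K + K)) * ((+ 1 + Y) - (K + K)) - (+ 1 + Y)) * b)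
      ≡ (((+ 1 + (+ 1 + Y)) - ((+ 1 + K) + (+ 1 + K))) * ((+ 1 + (+ 1 + Y)) - ((+ 1 + K) + (+ 1 + K))) - (+ 1 + (+ 1 + Y)))
        * ((+ 1 + (+ 1 + Y)) * b)
    collect = ℤ-Solver.solve-∀
    swap : ∀ a b c → a * (b * c) ≡ b * (a * c)
    swap = ℤ-Solver.solve-∀

  kraw-2-closed : ∀ k y → + suc (suc y) * + suc y * kraw 2 y k
                  ≡ ((+ suc (suc y) - (+ k + + k)) * (+ suc (suc y) - (+ k + + k)) - + suc (suc y)) * + binomial (suc (suc y)) k
  kraw-2-closed zero                y = base (+ y)
    where
    base : ∀ Y → (+ 1 + (+ 1 + Y)) * (+ 1 + Y) * + 1
           ≡ (((+ 1 + (+ 1 + Y)) - (+ 0 + + 0)) * ((+ 1 + (+ 1 + Y)) - (+ 0 + + 0)) - (+ 1 + (+ 1 + Y))) * + 1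
    base = ℤ-Solver.solve-∀
  kraw-2-closed (suc zero)          zero = refl
  kraw-2-closed (suc (suc zero))    zero = refl
  kraw-2-closed (suc (suc (suc k))) zero =
    trans (cong (+ 2 * + 1 *_) (trans (kraw-zeroʳ 2 (3 ℕ.+ k)) (ℤₚ.*-zeroʳ (sgn (3 ℕ.+ k)))))
          (sym (ℤₚ.*-zeroʳ ((+ 2 - (+ (3 ℕ.+ k) + + (3 ℕ.+ k))) * (+ 2 - (+ (3 ℕ.+ k) + + (3 ℕ.+ k))) - + 2)))
  kraw-2-closed (suc k)             (suc y) = ℤₚ.*-cancelˡ-≡ (+ suc k) _ _
    (kraw-2-closed-step (+ suc (suc (suc y))) (+ suc (suc y)) (+ suc y) (+ suc k) (+ k)
      (kraw 2 (suc y) (suc k)) (kraw 1 (suc y) k) (kraw 2 y k)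
      (+ binomial (suc (suc y)) k) (+ binomial (suc (suc (suc y))) (suc k))
      (ℤₚ.pos-+ 1 (suc (suc y))) (ℤₚ.pos-+ 1 (suc y)) (ℤₚ.pos-+ 1 k)
      (kraw-derivative 2 (suc y) k) (kraw-1-closed k (suc y)) (kraw-2-closed k y)
      (pos-absorption (suc (suc (suc y))) k))

  pos-difference : ∀ a s r → r ℕ.+ s ≡ a → + a - + s ≡ + r
  pos-difference .(r ℕ.+ s) s r refl = begin
    + (r ℕ.+ s) - + s   ≡⟨ cong (_- + s) (ℤₚ.pos-+ r s) ⟩
    + r + + s - + s     ≡⟨ cancel (+ r) (+ s) ⟩
    + r                 ∎
    where
    cancel : ∀ r s → r + s - s ≡ r
    cancel = ℤ-Solver.solve-∀

  nonneg-by-scaling : ∀ p g c → + suc p * g ≡ + c → g ≡ + ∣ g ∣ × suc p ℕ.* ∣ g ∣ ≡ c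
  nonneg-by-scaling p (+ a)    c e = refl , ℤₚ.+-injective (trans (ℤₚ.pos-* (suc p) a) e)
  nonneg-by-scaling p -[1+ a ] c ()

  kraw-1-closedℕ : ∀ k y m → m ℕ.+ (k ℕ.+ k) ≡ suc y →
                   kraw 1 y k ≡ + ∣ kraw 1 y k ∣ × suc y ℕ.* ∣ kraw 1 y k ∣ ≡ m ℕ.* binomial (suc y) k
  kraw-1-closedℕ k y m e = nonneg-by-scaling y (kraw 1 y k) (m ℕ.* binomial (suc y) k) (begin
    + suc y * kraw 1 y k                            ≡⟨ kraw-1-closed k y ⟩
    (+ suc y - (+ k + + k)) * + binomial (suc y) k  ≡⟨ cong (λ c → (+ suc y - c) * + binomial (suc y) k) (sym (ℤₚ.pos-+ k k)) ⟩
    (+ suc y - + (k ℕ.+ k)) * + binomial (suc y) k  ≡⟨ cong (_* + binomial (suc y) k) (pos-difference (suc y) (k ℕ.+ k) m e) ⟩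
    + m * + binomial (suc y) k                      ≡⟨ sym (ℤₚ.pos-* m (binomial (suc y) k)) ⟩
    + (m ℕ.* binomial (suc y) k)                    ∎)

  kraw-2-closedℕ : ∀ k u y → suc (suc y) ≡ u ℕ.+ 4 ℕ.* k →
                   kraw 2 y k ≡ + ∣ kraw 2 y k ∣ × suc (suc y) ℕ.* suc y ℕ.* ∣ kraw 2 y k ∣ ≡ Δ u k ℕ.* binomial (suc (suc y)) k
  kraw-2-closedℕ k u y e = nonneg-by-scaling (y ℕ.+ suc y ℕ.* suc y) (kraw 2 y k) (Δ u k ℕ.* b) (begin
    + (suc (suc y) ℕ.* suc y) * kraw 2 y k
      ≡⟨ cong (_* kraw 2 y k) (ℤₚ.pos-* (suc (suc y)) (suc y)) ⟩
    + suc (suc y) * + suc y * kraw 2 y k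
      ≡⟨ kraw-2-closed k y ⟩
    ((N - (+ k + + k)) * (N - (+ k + + k)) - N) * + b
      ≡⟨ cong (λ d → (d * d - N) * + b) (trans (cong (λ c → N - c) (sym (ℤₚ.pos-+ k k))) (pos-difference _ _ m gap)) ⟩
    (+ m * + m - N) * + b
      ≡⟨ cong (λ q → (q - N) * + b) (sym (ℤₚ.pos-* m m)) ⟩
    (+ (m ℕ.* m) - N) * + b
      ≡⟨ cong (_* + b) (pos-difference _ _ (Δ u k) (trans (cong (Δ u k ℕ.+_) e) (Δ+n≡m² u k))) ⟩
    + Δ u k * + b
      ≡⟨ sym (ℤₚ.pos-* (Δ u k) b) ⟩
    + (Δ u k ℕ.* b) ∎)
    where
    N : ℤ
    N = + suc (suc y)
    b m : ℕ
    b = binomial (suc (suc y)) k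
    m = u ℕ.+ 2 ℕ.* k
    gap : m ℕ.+ (k ℕ.+ k) ≡ suc (suc y)
    gap = trans (regroup u k) (sym e)
      where
      regroup : ∀ u k → u ℕ.+ 2 ℕ.* k ℕ.+ (k ℕ.+ k) ≡ u ℕ.+ 4 ℕ.* k
      regroup = ℕ-Solver.solve-∀

  kraw-two-stepℕ : ∀ k x y r → r ℕ.+ suc k ≡ x ℕ.+ y →
                   + (suc k ℕ.* r) * kraw x y (suc k)
                   ≡ + (y ℕ.* pred y) * kraw x (pred (pred y)) k - + (x ℕ.* pred x) * kraw (pred (pred x)) y k
  kraw-two-stepℕ k x y r e = begin
    + (suc k ℕ.* r) * kraw x y (suc k)
      ≡⟨ cong (_* kraw x y (suc k)) (ℤₚ.pos-* (suc k) r) ⟩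
    + suc k * + r * kraw x y (suc k)
      ≡⟨ cong (λ c → + suc k * c * kraw x y (suc k)) (sym (trans (cong (_- + suc k) (sym (ℤₚ.pos-+ x y))) (pos-difference _ _ r e))) ⟩
    + suc k * (+ x + + y - + suc k) * kraw x y (suc k)
      ≡⟨ kraw-two-step x y k ⟩
    + y * + pred y * kraw x (pred (pred y)) k - + x * + pred x * kraw (pred (pred x)) y k
      ≡⟨ cong₂ (λ a b → a * kraw x (pred (pred y)) k - b * kraw (pred (pred x)) y k)
               (sym (ℤₚ.pos-* y (pred y))) (sym (ℤₚ.pos-* x (pred x))) ⟩
    + (y ℕ.* pred y) * kraw x (pred (pred y)) k - + (x ℕ.* pred x) * kraw (pred (pred x)) y k ∎

  kraw-1-two-step : ∀ k M m → suc m ℕ.+ (suc k ℕ.+ suc k) ≡ suc (suc (suc M)) →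
                    suc k ℕ.* (suc m ℕ.+ suc k) ℕ.* ∣ kraw 1 (suc (suc M)) (suc k) ∣ ≡ suc (suc M) ℕ.* suc M ℕ.* ∣ kraw 1 M k ∣
  kraw-1-two-step k M m e = ℤₚ.+-injective (begin
    + (P ℕ.* ∣ g ∣)                        ≡⟨ ℤₚ.pos-* P ∣ g ∣ ⟩
    + P * + ∣ g ∣                          ≡⟨ cong (+ P *_) (sym g≥0) ⟩
    + P * g                                ≡⟨ kraw-two-stepℕ k 1 (suc (suc M)) r (trans (ℕₚ.+-assoc (suc m) (suc k) (suc k)) e) ⟩
    + Q * g′ - + 0 * kraw 0 (suc (suc M)) k ≡⟨ ℤₚ.+-identityʳ (+ Q * g′) ⟩
    + Q * g′                               ≡⟨ cong (+ Q *_) g′≥0 ⟩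
    + Q * + ∣ g′ ∣                         ≡⟨ sym (ℤₚ.pos-* Q ∣ g′ ∣) ⟩
    + (Q ℕ.* ∣ g′ ∣)                       ∎)
    where
    r P Q : ℕ
    r = suc m ℕ.+ suc k
    P = suc k ℕ.* r
    Q = suc (suc M) ℕ.* suc M
    g g′ : ℤ
    g = kraw 1 (suc (suc M)) (suc k)
    g′ = kraw 1 M k
    g≥0 : g ≡ + ∣ g ∣
    g≥0 = proj₁ (kraw-1-closedℕ (suc k) (suc (suc M)) (suc m) e)
    g′≥0 : g′ ≡ + ∣ g′ ∣
    g′≥0 = proj₁ (kraw-1-closedℕ k M (suc m) (m+[1+k+1+k]≡2+n⇒m+[k+k]≡n (suc m) k (suc M) e))

  kraw-2-two-step : ∀ k u L r → suc (suc (suc (suc L))) ≡ u ℕ.+ 4 ℕ.* suc k → r ℕ.+ suc k ≡ suc (suc (suc (suc L))) →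
                    suc k ℕ.* r ℕ.* ∣ kraw 2 (suc (suc L)) (suc k) ∣ ℕ.+ 2 ℕ.* binomial (suc (suc L)) k
                    ≡ suc (suc L) ℕ.* suc L ℕ.* ∣ kraw 2 L k ∣
  kraw-2-two-step k u L r e re = ℤₚ.+-injective (begin
    + (P ℕ.* ∣ g ∣ ℕ.+ 2 ℕ.* b)             ≡⟨ ℤₚ.pos-+ (P ℕ.* ∣ g ∣) (2 ℕ.* b) ⟩
    + (P ℕ.* ∣ g ∣) + + (2 ℕ.* b)           ≡⟨ cong₂ _+_ (trans (ℤₚ.pos-* P ∣ g ∣) (cong (+ P *_) (sym g≥0))) (ℤₚ.pos-* 2 b) ⟩
    + P * g + + 2 * + b                     ≡⟨ cong (_+ + 2 * + b) (kraw-two-stepℕ k 2 (suc (suc L)) r re) ⟩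
    + Q * g′ - + 2 * kraw 0 (suc (suc L)) k + + 2 * + b
                                            ≡⟨ cong (λ c → + Q * g′ - + 2 * c + + 2 * + b) (kraw-zeroˡ (suc (suc L)) k) ⟩
    + Q * g′ - + 2 * + b + + 2 * + b        ≡⟨ cancel (+ Q * g′) (+ 2 * + b) ⟩
    + Q * g′                                ≡⟨ trans (cong (+ Q *_) g′≥0) (sym (ℤₚ.pos-* Q ∣ g′ ∣)) ⟩
    + (Q ℕ.* ∣ g′ ∣)                        ∎)
    where
    P Q b : ℕ
    P = suc k ℕ.* r
    Q = suc (suc L) ℕ.* suc L
    b = binomial (suc (suc L)) k
    g g′ : ℤ
    g = kraw 2 (suc (suc L)) (suc k)
    g′ = kraw 2 L k
    g≥0 : g ≡ + ∣ g ∣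
    g≥0 = proj₁ (kraw-2-closedℕ (suc k) u (suc (suc L)) e)
    g′≥0 : g′ ≡ + ∣ g′ ∣
    g′≥0 = proj₁ (kraw-2-closedℕ k (suc (suc u)) L (2+n≡u+4[1+k]⇒n≡2+u+4k u k (suc (suc L)) e))
    cancel : ∀ a c → a - c + c ≡ a
    cancel = ℤ-Solver.solve-∀

module _ where
  open import Data.Nat using (_+_; _*_; _^_; _≤_; _<_)
  open ℕₚ.≤-Reasoning

  ≤-by-slack : ∀ {a b} c → a + c ≡ b → a ≤ b
  ≤-by-slack c eq = ℕₚ.≤-trans (ℕₚ.m≤m+n _ c) (ℕₚ.≤-reflexive eq)

  <⇒∃-gap : ∀ {a n} → a < n → ∃ λ m → suc m + a ≡ n
  <⇒∃-gap {a} {n} a<n = n ∸ suc a , trans (sym (ℕₚ.+-suc (n ∸ suc a) a)) (ℕₚ.m∸n+n≡m a<n)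

  1+k+1+k<2+n⇒k+k<n : ∀ {k n} → suc k + suc k < suc (suc n) → k + k < n
  1+k+1+k<2+n⇒k+k<n {k} c rewrite ℕₚ.+-suc k k = ℕₚ.≤-pred (ℕₚ.≤-pred c)

  wlog-≤ : (P : ℕ → ℕ → Set) → (∀ x y → P x y → P y x) → (∀ x y → x ≤ y → P x y) → ∀ x y → P x y
  wlog-≤ P sym-P ordered x y with ℕₚ.≤-total x y
  ... | inj₁ x≤y = ordered x y x≤y
  ... | inj₂ y≤x = sym-P y x (ordered y x y≤x)

  ∣kraw-derivative∣ : ∀ x y k → suc k * ∣ kraw x y (suc k) ∣ ≤ x * ∣ kraw (pred x) y k ∣ + y * ∣ kraw x (pred y) k ∣
  ∣kraw-derivative∣ x y k = begin
    suc k * ∣ kraw x y (suc k) ∣                ≡⟨ sym (ℤₚ.abs-* (+ suc k) (kraw x y (suc k))) ⟩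
    ∣ + suc k ℤ.* kraw x y (suc k) ∣            ≡⟨ cong ∣_∣ (kraw-derivative x y k) ⟩
    ∣ - (+ x ℤ.* a) ℤ.+ + y ℤ.* b ∣             ≤⟨ ℤₚ.∣i+j∣≤∣i∣+∣j∣ (- (+ x ℤ.* a)) (+ y ℤ.* b) ⟩
    ∣ - (+ x ℤ.* a) ∣ + ∣ + y ℤ.* b ∣           ≡⟨ cong₂ _+_ (trans (ℤₚ.∣-i∣≡∣i∣ (+ x ℤ.* a)) (ℤₚ.abs-* (+ x) a)) (ℤₚ.abs-* (+ y) b) ⟩
    x * ∣ a ∣ + y * ∣ b ∣                       ∎
    where
    a b : ℤ
    a = kraw (pred x) y k
    b = kraw x (pred y) k

  ∣kraw∣≤binomial : ∀ k x y → ∣ kraw x y k ∣ ≤ binomial (x + y) k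
  ∣kraw∣≤binomial zero    x       y = ℕₚ.≤-refl
  ∣kraw∣≤binomial (suc k) zero    y = ℕₚ.≤-reflexive (cong ∣_∣ (kraw-zeroˡ y (suc k)))
  ∣kraw∣≤binomial (suc k) (suc x) y = ℕₚ.*-cancelˡ-≤ (suc k) (begin
    suc k * ∣ kraw (suc x) y (suc k) ∣
      ≤⟨ ∣kraw-derivative∣ (suc x) y k ⟩
    suc x * ∣ kraw x y k ∣ + y * ∣ kraw (suc x) (pred y) k ∣
      ≤⟨ ℕₚ.+-mono-≤ (ℕₚ.*-monoʳ-≤ (suc x) (∣kraw∣≤binomial k x y)) (y-part y) ⟩
    suc x * binomial (x + y) k + y * binomial (x + y) k
      ≡⟨ sym (ℕₚ.*-distribʳ-+ (binomial (x + y) k) (suc x) y) ⟩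
    suc (x + y) * binomial (x + y) k
      ≡⟨ sym (binomial-absorption (x + y) k) ⟩
    suc k * binomial (suc x + y) (suc k) ∎)
    where
    y-part : ∀ y → y * ∣ kraw (suc x) (pred y) k ∣ ≤ y * binomial (x + y) k
    y-part zero    = z≤n
    y-part (suc y) = ℕₚ.*-monoʳ-≤ (suc y)
      (ℕₚ.≤-trans (∣kraw∣≤binomial k (suc x) y) (ℕₚ.≤-reflexive (cong (λ n → binomial n k) (sym (ℕₚ.+-suc x y)))))

  ∣kraw-two-step∣ : ∀ k x y r → r + suc k ≡ x + y →
                    suc k * r * ∣ kraw x y (suc k) ∣
                    ≤ y * pred y * ∣ kraw x (pred (pred y)) k ∣ + x * pred x * ∣ kraw (pred (pred x)) y k ∣
  ∣kraw-two-step∣ k x y r e = begin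
    suc k * r * ∣ kraw x y (suc k) ∣        ≡⟨ sym (ℤₚ.abs-* (+ (suc k * r)) (kraw x y (suc k))) ⟩
    ∣ + (suc k * r) ℤ.* kraw x y (suc k) ∣  ≡⟨ cong ∣_∣ (kraw-two-stepℕ k x y r e) ⟩
    ∣ + c₁ ℤ.* a ℤ.- + c₂ ℤ.* b ∣           ≤⟨ ℤₚ.∣i-j∣≤∣i∣+∣j∣ (+ c₁ ℤ.* a) (+ c₂ ℤ.* b) ⟩
    ∣ + c₁ ℤ.* a ∣ + ∣ + c₂ ℤ.* b ∣         ≡⟨ cong₂ _+_ (ℤₚ.abs-* (+ c₁) a) (ℤₚ.abs-* (+ c₂) b) ⟩
    c₁ * ∣ a ∣ + c₂ * ∣ b ∣                 ∎
    where
    c₁ c₂ : ℕ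
    c₁ = y * pred y
    c₂ = x * pred x
    a b : ℤ
    a = kraw x (pred (pred y)) k
    b = kraw (pred (pred x)) y k

  -- |K_k(i)| ≤ |K_k(1)| for n = x + y + 2 and i = x + 1
  Dominated₁ : ℕ → Set
  Dominated₁ k = ∀ x y → k + k < suc x + suc y → ∣ kraw (suc x) (suc y) k ∣ ≤ ∣ kraw 1 (x + suc y) k ∣

  dominated₁-by-two-step : ∀ k X Y M → X + Y ≡ 3 + M → suc k + suc k < X + Y →
    Y * pred Y * ∣ kraw X (pred (pred Y)) k ∣ + X * pred X * ∣ kraw (pred (pred X)) Y k ∣ ≤ (2 + M) * (1 + M) * ∣ kraw 1 M k ∣ →
    ∣ kraw X Y (suc k) ∣ ≤ ∣ kraw 1 (2 + M) (suc k) ∣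
  dominated₁-by-two-step k X Y M n≡ c reduced with <⇒∃-gap c
  ... | m , gap = ℕₚ.*-cancelˡ-≤ (suc k * (suc m + suc k)) (begin
    suc k * (suc m + suc k) * ∣ kraw X Y (suc k) ∣
      ≤⟨ ∣kraw-two-step∣ k X Y (suc m + suc k) (trans (ℕₚ.+-assoc (suc m) (suc k) (suc k)) gap) ⟩
    Y * pred Y * ∣ kraw X (pred (pred Y)) k ∣ + X * pred X * ∣ kraw (pred (pred X)) Y k ∣
      ≤⟨ reduced ⟩
    (2 + M) * (1 + M) * ∣ kraw 1 M k ∣
      ≡⟨ sym (kraw-1-two-step k M m (trans gap n≡)) ⟩
    suc k * (suc m + suc k) * ∣ kraw 1 (2 + M) (suc k) ∣ ∎)

  binomial≤kraw-1 : ∀ k y → k + k < suc y → binomial (suc y) k ≤ suc y * ∣ kraw 1 y k ∣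
  binomial≤kraw-1 k y c with <⇒∃-gap c
  ... | m , gap = begin
    binomial (suc y) k          ≤⟨ ℕₚ.m≤m+n (binomial (suc y) k) (m * binomial (suc y) k) ⟩
    suc m * binomial (suc y) k  ≡⟨ sym (proj₂ (kraw-1-closedℕ k y (suc m) gap)) ⟩
    suc y * ∣ kraw 1 y k ∣      ∎

  kraw-1-nonneg : ∀ k y → k + k < suc y → kraw 1 y k ≡ + ∣ kraw 1 y k ∣
  kraw-1-nonneg k y c = proj₁ (kraw-1-closedℕ k y (suc (proj₁ (<⇒∃-gap c))) (proj₂ (<⇒∃-gap c)))

  dominated₁-at-2 : ∀ k → Dominated₁ k → ∀ y → k + k < 2 + y → ∣ kraw 2 y k ∣ ≤ ∣ kraw 1 (1 + y) k ∣
  dominated₁-at-2 zero    _  y       _ = ℕₚ.≤-refl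
  dominated₁-at-2 (suc k) _  zero    c = contradiction (ℕₚ.≤-trans (ℕₚ.m≤n+m (suc k) k) (ℕₚ.≤-pred (ℕₚ.≤-pred c))) λ ()
  dominated₁-at-2 (suc k) ih (suc y) c = ih 1 y c

  dominated₁-step-at-2 : ∀ k → Dominated₁ k → ∀ b → suc k + suc k < 2 + (2 + b) →
                         ∣ kraw 2 (2 + b) (suc k) ∣ ≤ ∣ kraw 1 (3 + b) (suc k) ∣
  dominated₁-step-at-2 k ih b c = dominated₁-by-two-step k 2 (2 + b) (1 + b) refl c (begin
    (2 + b) * (1 + b) * ∣ kraw 2 b k ∣ + 2 * ∣ kraw 0 (2 + b) k ∣
      ≤⟨ ℕₚ.+-mono-≤ (ℕₚ.*-monoʳ-≤ ((2 + b) * (1 + b)) (dominated₁-at-2 k ih b c′))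
                     (ℕₚ.*-monoʳ-≤ 2 (ℕₚ.≤-trans (ℕₚ.≤-reflexive (cong ∣_∣ (kraw-zeroˡ (2 + b) k))) (binomial≤kraw-1 k (1 + b) c′))) ⟩
    (2 + b) * (1 + b) * g + 2 * ((2 + b) * g)
      ≡⟨ collect b g ⟩
    (3 + b) * (2 + b) * g ∎)
    where
    g : ℕ
    g = ∣ kraw 1 (1 + b) k ∣
    c′ : k + k < 2 + b
    c′ = 1+k+1+k<2+n⇒k+k<n c
    collect : ∀ b g → (2 + b) * (1 + b) * g + 2 * ((2 + b) * g) ≡ (3 + b) * (2 + b) * g
    collect = ℕ-Solver.solve-∀

  dominated₁-step-generic : ∀ k → Dominated₁ k → ∀ a b → suc k + suc k < (3 + a) + (3 + b) →
                            ∣ kraw (3 + a) (3 + b) (suc k) ∣ ≤ ∣ kraw 1 (2 + a + (3 + b)) (suc k) ∣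
  dominated₁-step-generic k ih a b c = dominated₁-by-two-step k X Y M refl c (begin
    Y * pred Y * ∣ kraw X (1 + b) k ∣ + X * pred X * ∣ kraw (1 + a) Y k ∣
      ≤⟨ ℕₚ.+-mono-≤ (ℕₚ.*-monoʳ-≤ (Y * pred Y) first) (ℕₚ.*-monoʳ-≤ (X * pred X) second) ⟩
    Y * pred Y * g + X * pred X * g
      ≤⟨ ≤-by-slack (2 * (2 + a) * (2 + b) * g) (collect a b g) ⟩
    (2 + M) * (1 + M) * g ∎)
    where
    X Y M g : ℕ
    X = 3 + a
    Y = 3 + b
    M = a + Y
    g = ∣ kraw 1 M k ∣
    c′ : k + k < (1 + a) + Y
    c′ = 1+k+1+k<2+n⇒k+k<n c
    shift : ∀ a b → (1 + a) + (3 + b) ≡ (3 + a) + (1 + b)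
    shift = ℕ-Solver.solve-∀
    first : ∣ kraw X (1 + b) k ∣ ≤ g
    first = ℕₚ.≤-trans (ih (2 + a) b (subst (k + k <_) (shift a b) c′))
                       (ℕₚ.≤-reflexive (cong (λ n → ∣ kraw 1 n k ∣) (ℕₚ.suc-injective (sym (shift a b)))))
    second : ∣ kraw (1 + a) Y k ∣ ≤ g
    second = ih a (2 + b) c′
    -- the slack is 2(X − 1)(Y − 1) g
    collect : ∀ a b g → (3 + b) * (2 + b) * g + (3 + a) * (2 + a) * g + 2 * (2 + a) * (2 + b) * g
                        ≡ (2 + (a + (3 + b))) * (1 + (a + (3 + b))) * g
    collect = ℕ-Solver.solve-∀

  dominated₁-step : ∀ k → Dominated₁ k → ∀ x y → x ≤ y → suc k + suc k < suc x + suc y →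
                    ∣ kraw (suc x) (suc y) (suc k) ∣ ≤ ∣ kraw 1 (x + suc y) (suc k) ∣
  dominated₁-step k ih zero          y             _        _ = ℕₚ.≤-refl
  dominated₁-step k ih (suc zero)    zero          ()       _
  dominated₁-step k ih (suc zero)    (suc b)       _        c = dominated₁-step-at-2 k ih b c
  dominated₁-step k ih (suc (suc a)) zero          ()       _
  dominated₁-step k ih (suc (suc a)) (suc zero)    (s≤s ()) _
  dominated₁-step k ih (suc (suc a)) (suc (suc b)) _        c = dominated₁-step-generic k ih a b c

  dominated₁ : ∀ k → Dominated₁ k
  dominated₁ zero    x y _ = ℕₚ.≤-refl
  dominated₁ (suc k) = wlog-≤ _ swap (dominated₁-step k (dominated₁ k))
    where
    swap : ∀ x y → (suc k + suc k < suc x + suc y → ∣ kraw (suc x) (suc y) (suc k) ∣ ≤ ∣ kraw 1 (x + suc y) (suc k) ∣)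
                 → (suc k + suc k < suc y + suc x → ∣ kraw (suc y) (suc x) (suc k) ∣ ≤ ∣ kraw 1 (y + suc x) (suc k) ∣)
    swap x y h c = begin
      ∣ kraw (suc y) (suc x) (suc k) ∣  ≡⟨ ∣kraw-swap∣ (suc k) (suc x) (suc y) ⟩
      ∣ kraw (suc x) (suc y) (suc k) ∣  ≤⟨ h (subst (suc k + suc k <_) (ℕₚ.+-comm (suc y) (suc x)) c) ⟩
      ∣ kraw 1 (x + suc y) (suc k) ∣    ≡⟨ cong (λ n → ∣ kraw 1 n (suc k) ∣) (exchange x y) ⟩
      ∣ kraw 1 (y + suc x) (suc k) ∣    ∎
      where
      exchange : ∀ x y → x + suc y ≡ y + suc x
      exchange = ℕ-Solver.solve-∀

  -- k ≤ τ(n) for n = u + 4k, with the square root cleared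
  BelowTau : ℕ → ℕ → Set
  BelowTau u k = 8 * k ≤ u * u + 6 * u + 8

  belowTau-pred : ∀ u k → BelowTau u (suc k) → BelowTau (suc (suc u)) k
  belowTau-pred u k below = begin
    8 * k                                                       ≤⟨ ℕₚ.m≤n+m (8 * k) 8 ⟩
    8 + 8 * k                                                   ≡⟨ ℕₚ.*-suc 8 k ⟨
    8 * suc k                                                   ≤⟨ below ⟩
    u * u + 6 * u + 8                                           ≤⟨ ≤-by-slack (4 * u + 16) (expand u) ⟩
    suc (suc u) * suc (suc u) + 6 * suc (suc u) + 8             ∎
    where
    expand : ∀ u → u * u + 6 * u + 8 + (4 * u + 16) ≡ suc (suc u) * suc (suc u) + 6 * suc (suc u) + 8
    expand = ℕ-Solver.solve-∀

  3m+2n≤m² : ∀ u k c → 7 + c ≡ u + 4 * suc k → BelowTau u (suc k) →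
             3 * (suc (suc u) + 2 * k) + ((suc (suc u) + 4 * k) + (suc (suc u) + 4 * k))
             ≤ (suc (suc u) + 2 * k) * (suc (suc u) + 2 * k)
  3m+2n≤m² zero                zero    c () below
  3m+2n≤m² (suc zero)          zero    c () below
  3m+2n≤m² (suc (suc zero))    zero    c () below
  3m+2n≤m² (suc (suc (suc a))) zero    c _  _     = ≤-by-slack (a * a + 5 * a) (expand a)
    where
    expand : ∀ a → 3 * (suc (suc (suc (suc (suc a)))) + 2 * 0)
                     + ((suc (suc (suc (suc (suc a)))) + 4 * 0) + (suc (suc (suc (suc (suc a)))) + 4 * 0))
                     + (a * a + 5 * a)
                   ≡ (suc (suc (suc (suc (suc a)))) + 2 * 0) * (suc (suc (suc (suc (suc a)))) + 2 * 0)
    expand = ℕ-Solver.solve-∀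
  3m+2n≤m² zero                (suc k) c _  below = contradiction (ℕₚ.≤-trans (ℕₚ.*-monoʳ-≤ 8 (s≤s (s≤s (z≤n {k})))) below) (ℕₚ.<⇒≱ (ℕₚ.m<m+n 8 {8} (s≤s z≤n)))
  3m+2n≤m² (suc zero)          (suc k) c _  below = contradiction (ℕₚ.≤-trans (ℕₚ.*-monoʳ-≤ 8 (s≤s (s≤s (z≤n {k})))) below) (ℕₚ.<⇒≱ (ℕₚ.n<1+n 15))
  3m+2n≤m² (suc (suc a))       (suc j) c _  _     = ≤-by-slack (a * a + 7 * a + 4 * j * j + 10 * j + 2 + 4 * a * j) (expand a j)
    where
    expand : ∀ a j → 3 * (suc (suc (suc (suc a))) + 2 * suc j)
                       + ((suc (suc (suc (suc a))) + 4 * suc j) + (suc (suc (suc (suc a))) + 4 * suc j))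
                       + (a * a + 7 * a + 4 * j * j + 10 * j + 2 + 4 * a * j)
                     ≡ (suc (suc (suc (suc a))) + 2 * suc j) * (suc (suc (suc (suc a))) + 2 * suc j)
    expand = ℕ-Solver.solve-∀

  3m+n≤Δ : ∀ u k c → 7 + c ≡ u + 4 * suc k → BelowTau u (suc k) →
           3 * (suc (suc u) + 2 * k) + (suc (suc u) + 4 * k) ≤ Δ (suc (suc u)) k
  3m+n≤Δ u k c n≡ below = ℕₚ.+-cancelʳ-≤ n (3 * m + n) (Δ (suc (suc u)) k)
    (ℕₚ.≤-trans (ℕₚ.≤-reflexive (ℕₚ.+-assoc (3 * m) n n))
                (ℕₚ.≤-trans (3m+2n≤m² u k c n≡ below) (ℕₚ.≤-reflexive (sym (Δ+n≡m² (suc (suc u)) k)))))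
    where
    m n : ℕ
    m = suc (suc u) + 2 * k
    n = suc (suc u) + 4 * k

  [L+2][L+1]≤[3+2s]Δ : ∀ s u k → s + 4 ≡ u + 4 * k → suc (suc (s + 4)) * suc (s + 4) ≤ (3 + 2 * s) * Δ (suc (suc u)) k
  [L+2][L+1]≤[3+2s]Δ s u zero    n≡ with sym (trans n≡ (ℕₚ.+-identityʳ u))
  ... | refl = ≤-by-slack ((2 + 2 * s) * (suc (suc (s + 4)) * suc (s + 4))) (expand s)
    where
    expand : ∀ s → suc (suc (s + 4)) * suc (s + 4) + (2 + 2 * s) * (suc (suc (s + 4)) * suc (s + 4))
                   ≡ (3 + 2 * s) * (suc (suc (s + 4)) * suc (s + 4) + 4 * suc (suc (s + 4)) * 0 + 4 * 0 * 0)
    expand = ℕ-Solver.solve-∀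
  [L+2][L+1]≤[3+2s]Δ s u (suc j) n≡ with ℕₚ.+-cancelʳ-≡ 4 s (u + 4 * j) (trans n≡ (regroup u j))
    where
    regroup : ∀ u j → u + 4 * suc j ≡ u + 4 * j + 4
    regroup = ℕ-Solver.solve-∀
  ... | refl = ≤-by-slack (72 * j + 92 * j * j + 32 * j * j * j + 30 * u + 84 * u * j + 40 * u * j * j
                           + 16 * u * u + 16 * u * u * j + 2 * u * u * u) (expand u j)
    where
    expand : ∀ u j → suc (suc (u + 4 * j + 4)) * suc (u + 4 * j + 4)
                     + (72 * j + 92 * j * j + 32 * j * j * j + 30 * u + 84 * u * j + 40 * u * j * j
                        + 16 * u * u + 16 * u * u * j + 2 * u * u * u)
                     ≡ (3 + 2 * (u + 4 * j)) * (suc (suc u) * suc u + 4 * suc (suc u) * suc j + 4 * suc j * j)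
    expand = ℕ-Solver.solve-∀

  binomial≤[3+2s]kraw-2 : ∀ k u s L → L ≡ s + 4 → suc (suc L) ≡ suc (suc u) + 4 * k →
                          binomial (suc (suc L)) k ≤ (3 + 2 * s) * ∣ kraw 2 L k ∣
  binomial≤[3+2s]kraw-2 k u s .(s + 4) refl n≡ = ℕₚ.*-cancelˡ-≤ (suc (suc L) * suc L) (begin
    suc (suc L) * suc L * B                 ≤⟨ ℕₚ.*-monoˡ-≤ B ([L+2][L+1]≤[3+2s]Δ s u k (ℕₚ.suc-injective (ℕₚ.suc-injective n≡))) ⟩
    (3 + 2 * s) * Δ (suc (suc u)) k * B     ≡⟨ ℕₚ.*-assoc (3 + 2 * s) (Δ (suc (suc u)) k) B ⟩
    (3 + 2 * s) * (Δ (suc (suc u)) k * B)   ≡⟨ cong ((3 + 2 * s) *_) (sym (proj₂ (kraw-2-closedℕ k (suc (suc u)) L n≡))) ⟩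
    (3 + 2 * s) * (suc (suc L) * suc L * g) ≡⟨ swap (3 + 2 * s) (suc (suc L) * suc L) g ⟩
    suc (suc L) * suc L * ((3 + 2 * s) * g) ∎)
    where
    L B g : ℕ
    L = s + 4
    B = binomial (suc (suc L)) k
    g = ∣ kraw 2 L k ∣
    swap : ∀ a b c → a * (b * c) ≡ b * (a * c)
    swap = ℕ-Solver.solve-∀

  3kraw-1+binomial≤kraw-2 : ∀ k u c → 7 + c ≡ u + 4 * suc k → BelowTau u (suc k) →
                            3 * ∣ kraw 1 (4 + c) k ∣ + binomial (5 + c) k ≤ (4 + c) * ∣ kraw 2 (3 + c) k ∣
  3kraw-1+binomial≤kraw-2 k u c n≡ below = ℕₚ.*-cancelˡ-≤ (suc (suc L) * suc L) (begin
    suc (suc L) * suc L * (3 * g₁ + B)            ≡⟨ spread (suc (suc L)) (suc L) g₁ B ⟩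
    3 * suc L * (suc (suc L) * g₁) + suc (suc L) * suc L * B
                                                  ≡⟨ cong (λ t → 3 * suc L * t + suc (suc L) * suc L * B) closed₁ ⟩
    3 * suc L * (m * B) + suc (suc L) * suc L * B ≡⟨ gather (suc (suc L)) (suc L) m B ⟩
    suc L * ((3 * m + suc (suc L)) * B)           ≤⟨ ℕₚ.*-monoʳ-≤ (suc L) (ℕₚ.*-monoˡ-≤ B weight) ⟩
    suc L * (Δ (suc (suc u)) k * B)               ≡⟨ cong (suc L *_) (sym closed₂) ⟩
    suc L * (suc (suc L) * suc L * g₂)            ≡⟨ swap (suc L) (suc (suc L) * suc L) g₂ ⟩
    suc (suc L) * suc L * (suc L * g₂)            ∎)
    where
    L B g₁ g₂ m : ℕ
    L = suc (suc (suc c))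
    B = binomial (suc (suc L)) k
    g₁ = ∣ kraw 1 (suc L) k ∣
    g₂ = ∣ kraw 2 L k ∣
    m = suc (suc u) + 2 * k
    n≡′ : suc (suc L) ≡ suc (suc u) + 4 * k
    n≡′ = 2+n≡u+4[1+k]⇒n≡2+u+4k u k (suc (suc L)) n≡
    closed₁ : suc (suc L) * g₁ ≡ m * B
    closed₁ = proj₂ (kraw-1-closedℕ k (suc L) m (trans (regroup u k) (sym n≡′)))
      where
      regroup : ∀ u k → suc (suc u) + 2 * k + (k + k) ≡ suc (suc u) + 4 * k
      regroup = ℕ-Solver.solve-∀
    closed₂ : suc (suc L) * suc L * g₂ ≡ Δ (suc (suc u)) k * B
    closed₂ = proj₂ (kraw-2-closedℕ k (suc (suc u)) L n≡′)
    weight : 3 * m + suc (suc L) ≤ Δ (suc (suc u)) k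
    weight = subst (λ n → 3 * m + n ≤ Δ (suc (suc u)) k) (sym n≡′) (3m+n≤Δ u k c n≡ below)
    spread : ∀ A S g B → A * S * (3 * g + B) ≡ 3 * S * (A * g) + A * S * B
    spread = ℕ-Solver.solve-∀
    gather : ∀ A S m B → 3 * S * (m * B) + A * S * B ≡ S * ((3 * m + A) * B)
    gather = ℕ-Solver.solve-∀
    swap : ∀ a b c → a * (b * c) ≡ b * (a * c)
    swap = ℕ-Solver.solve-∀

  -- |K_k(i)| ≤ |K_k(2)| for n = x + y + 4 = u + 4k and i = x + 2
  Dominated₂ : ℕ → ℕ → Set
  Dominated₂ u k = ∀ x y → 2 + x + (2 + y) ≡ u + 4 * k → ∣ kraw (2 + x) (2 + y) k ∣ ≤ ∣ kraw 2 (x + (2 + y)) k ∣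

  dominated₂-by-two-step : ∀ k u X Y L → X + Y ≡ 4 + L → X + Y ≡ u + 4 * suc k →
    Y * pred Y * ∣ kraw X (pred (pred Y)) k ∣ + X * pred X * ∣ kraw (pred (pred X)) Y k ∣ + 2 * binomial (2 + L) k
      ≤ (2 + L) * (1 + L) * ∣ kraw 2 L k ∣ →
    ∣ kraw X Y (suc k) ∣ ≤ ∣ kraw 2 (2 + L) (suc k) ∣
  dominated₂-by-two-step k u X Y L n≡L n≡u reduced =
    ℕₚ.*-cancelˡ-≤ (suc k * r) (ℕₚ.+-cancelʳ-≤ (2 * B) _ _ (begin
      suc k * r * ∣ kraw X Y (suc k) ∣ + 2 * B
        ≤⟨ ℕₚ.+-monoˡ-≤ (2 * B) (∣kraw-two-step∣ k X Y r (trans r+k≡ (sym n≡u))) ⟩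
      Y * pred Y * ∣ kraw X (pred (pred Y)) k ∣ + X * pred X * ∣ kraw (pred (pred X)) Y k ∣ + 2 * B
        ≤⟨ reduced ⟩
      (2 + L) * (1 + L) * ∣ kraw 2 L k ∣
        ≡⟨ sym (kraw-2-two-step k u L r (trans (sym n≡L) n≡u) (trans r+k≡ (trans (sym n≡u) n≡L))) ⟩
      suc k * r * ∣ kraw 2 (2 + L) (suc k) ∣ + 2 * B ∎))
    where
    B r : ℕ
    B = binomial (2 + L) k
    r = 3 + (u + 3 * k)
    r+k≡ : r + suc k ≡ u + 4 * suc k
    r+k≡ = regroup u k
      where
      regroup : ∀ u k → 3 + (u + 3 * k) + suc k ≡ u + 4 * suc k
      regroup = ℕ-Solver.solve-∀

  dominated₂-step-at-3 : ∀ k u → BelowTau u (suc k) → Dominated₂ (2 + u) k → ∀ c → 3 + (4 + c) ≡ u + 4 * suc k →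
                         ∣ kraw 3 (4 + c) (suc k) ∣ ≤ ∣ kraw 2 (5 + c) (suc k) ∣
  dominated₂-step-at-3 k u below ih c n≡ = dominated₂-by-two-step k u 3 (4 + c) (3 + c) refl n≡ (begin
    (4 + c) * (3 + c) * ∣ kraw 3 (2 + c) k ∣ + 3 * 2 * g₁ + 2 * B
      ≤⟨ ℕₚ.+-monoˡ-≤ (2 * B) (ℕₚ.+-monoˡ-≤ (3 * 2 * g₁) (ℕₚ.*-monoʳ-≤ ((4 + c) * (3 + c))
           (ih 1 c (2+n≡u+4[1+k]⇒n≡2+u+4k u k (5 + c) n≡)))) ⟩
    (4 + c) * (3 + c) * g₂ + 3 * 2 * g₁ + 2 * B
      ≡⟨ regroup ((4 + c) * (3 + c) * g₂) g₁ B ⟩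
    (4 + c) * (3 + c) * g₂ + 2 * (3 * g₁ + B)
      ≤⟨ ℕₚ.+-monoʳ-≤ ((4 + c) * (3 + c) * g₂) (ℕₚ.*-monoʳ-≤ 2 (3kraw-1+binomial≤kraw-2 k u c n≡ below)) ⟩
    (4 + c) * (3 + c) * g₂ + 2 * ((4 + c) * g₂)
      ≡⟨ collect c g₂ ⟩
    (5 + c) * (4 + c) * g₂ ∎)
    where
    B g₁ g₂ : ℕ
    B = binomial (5 + c) k
    g₁ = ∣ kraw 1 (4 + c) k ∣
    g₂ = ∣ kraw 2 (3 + c) k ∣
    regroup : ∀ a g B → a + 3 * 2 * g + 2 * B ≡ a + 2 * (3 * g + B)
    regroup = ℕ-Solver.solve-∀
    collect : ∀ c g → (4 + c) * (3 + c) * g + 2 * ((4 + c) * g) ≡ (5 + c) * (4 + c) * g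
    collect = ℕ-Solver.solve-∀

  dominated₂-step-generic : ∀ k u → Dominated₂ (2 + u) k → ∀ a b → 4 + a + (4 + b) ≡ u + 4 * suc k →
                            ∣ kraw (4 + a) (4 + b) (suc k) ∣ ≤ ∣ kraw 2 (2 + a + (4 + b)) (suc k) ∣
  dominated₂-step-generic k u ih a b n≡ = dominated₂-by-two-step k u X Y L refl n≡ (begin
    Y * pred Y * ∣ kraw X (2 + b) k ∣ + X * pred X * ∣ kraw (2 + a) Y k ∣ + 2 * B
      ≤⟨ ℕₚ.+-mono-≤ (ℕₚ.+-mono-≤ (ℕₚ.*-monoʳ-≤ (Y * pred Y) first) (ℕₚ.*-monoʳ-≤ (X * pred X) second))
                     (ℕₚ.*-monoʳ-≤ 2 (binomial≤[3+2s]kraw-2 k u (a + b) L (L≡ a b) n≡′)) ⟩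
    Y * pred Y * g + X * pred X * g + 2 * ((3 + 2 * (a + b)) * g)
      ≤⟨ ≤-by-slack (2 * a * b * g) (collect a b g) ⟩
    (2 + L) * (1 + L) * g ∎)
    where
    X Y L B g : ℕ
    X = 4 + a
    Y = 4 + b
    L = a + Y
    B = binomial (2 + L) k
    g = ∣ kraw 2 L k ∣
    n≡′ : 2 + L ≡ 2 + u + 4 * k
    n≡′ = 2+n≡u+4[1+k]⇒n≡2+u+4k u k (2 + L) n≡
    L≡ : ∀ a b → a + (4 + b) ≡ a + b + 4
    L≡ = ℕ-Solver.solve-∀
    shift : ∀ a b → 2 + a + (2 + b) ≡ a + (4 + b)
    shift = ℕ-Solver.solve-∀
    first : ∣ kraw X (2 + b) k ∣ ≤ g
    first = ℕₚ.≤-trans (ih (2 + a) b (trans (cong (λ n → 2 + n) (shift a b)) n≡′))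
                       (ℕₚ.≤-reflexive (cong (λ n → ∣ kraw 2 n k ∣) (shift a b)))
    second : ∣ kraw (2 + a) Y k ∣ ≤ g
    second = ih a (2 + b) n≡′
    -- (2 + L)(1 + L) − X(X − 1) − Y(Y − 1) = 2(X − 2)(Y − 2) − 2 = 2(3 + 2(a + b)) + 2ab
    collect : ∀ a b g → (4 + b) * (3 + b) * g + (4 + a) * (3 + a) * g + 2 * ((3 + 2 * (a + b)) * g) + 2 * a * b * g
                        ≡ (2 + (a + (4 + b))) * (1 + (a + (4 + b))) * g
    collect = ℕ-Solver.solve-∀

  dominated₂-step : ∀ k u → BelowTau u (suc k) → Dominated₂ (2 + u) k → ∀ x y → x ≤ y →
                    2 + x + (2 + y) ≡ u + 4 * suc k → ∣ kraw (2 + x) (2 + y) (suc k) ∣ ≤ ∣ kraw 2 (x + (2 + y)) (suc k) ∣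
  dominated₂-step k       u below ih zero          y             _        _  = ℕₚ.≤-refl
  dominated₂-step k       u below ih (suc zero)    zero          ()       _
  dominated₂-step zero    u below ih (suc zero)    (suc zero)    _        _  = z≤n
  dominated₂-step (suc k) u below ih (suc zero)    (suc zero)    _        n≡ =
    contradiction (subst (8 ≤_) (sym n≡) (ℕₚ.≤-trans (ℕₚ.*-monoʳ-≤ 4 (s≤s (s≤s (z≤n {k})))) (ℕₚ.m≤n+m _ u)))
                  (ℕₚ.<⇒≱ (ℕₚ.m<m+n 6 {2} (s≤s z≤n)))
  dominated₂-step k       u below ih (suc zero)    (suc (suc c)) _        n≡ = dominated₂-step-at-3 k u below ih c n≡
  dominated₂-step k       u below ih (suc (suc a)) zero          ()       _
  dominated₂-step k       u below ih (suc (suc a)) (suc zero)    (s≤s ()) _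
  dominated₂-step k       u below ih (suc (suc a)) (suc (suc b)) _        n≡ = dominated₂-step-generic k u ih a b n≡

  dominated₂ : ∀ k u → BelowTau u k → Dominated₂ u k
  dominated₂ zero    u below x y _ = ℕₚ.≤-refl
  dominated₂ (suc k) u below = wlog-≤ _ swap (dominated₂-step k u below (dominated₂ k (2 + u) (belowTau-pred u k below)))
    where
    swap : ∀ x y → (2 + x + (2 + y) ≡ u + 4 * suc k → ∣ kraw (2 + x) (2 + y) (suc k) ∣ ≤ ∣ kraw 2 (x + (2 + y)) (suc k) ∣)
                 → (2 + y + (2 + x) ≡ u + 4 * suc k → ∣ kraw (2 + y) (2 + x) (suc k) ∣ ≤ ∣ kraw 2 (y + (2 + x)) (suc k) ∣)
    swap x y h n≡ = begin
      ∣ kraw (2 + y) (2 + x) (suc k) ∣  ≡⟨ ∣kraw-swap∣ (suc k) (2 + x) (2 + y) ⟩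
      ∣ kraw (2 + x) (2 + y) (suc k) ∣  ≤⟨ h (trans (ℕₚ.+-comm (2 + x) (2 + y)) n≡) ⟩
      ∣ kraw 2 (x + (2 + y)) (suc k) ∣  ≡⟨ cong (λ n → ∣ kraw 2 n (suc k) ∣) (exchange x y) ⟩
      ∣ kraw 2 (y + (2 + x)) (suc k) ∣  ∎
      where
      exchange : ∀ x y → x + (2 + y) ≡ y + (2 + x)
      exchange = ℕ-Solver.solve-∀

  large-square-root : ∀ n s → 4 ≤ n → 2 * (n + 4) ≤ s * s → 4 ≤ s
  large-square-root n s 4≤n sq with 4 ℕ.≤? s
  ... | yes 4≤s = 4≤s
  ... | no  4≰s = contradiction (ℕₚ.≤-trans sixteen≤ (ℕₚ.≤-trans sq (ℕₚ.*-mono-≤ s≤3 s≤3))) (ℕₚ.<⇒≱ (ℕₚ.m<m+n 9 {7} (s≤s z≤n)))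
    where
    s≤3 : s ≤ 3
    s≤3 = ℕₚ.≤-pred (ℕₚ.≰⇒> 4≰s)
    sixteen≤ : 16 ≤ 2 * (n + 4)
    sixteen≤ = ℕₚ.*-monoʳ-≤ 2 (ℕₚ.+-monoˡ-≤ 4 4≤n)

  k≤τ⇒BelowTau : ∀ n k → 4 ≤ n → 4 * k ≤ n + 4 → 2 * (n + 4) ≤ ((n + 4) ∸ 4 * k) ^ 2 →
                 ∃ λ u → n ≡ u + 4 * k × BelowTau u k
  k≤τ⇒BelowTau n k 4≤n 4k≤n+4 sq = u , sym (ℕₚ.m∸n+n≡m 4k≤n) , below
    where
    s u : ℕ
    s = (n + 4) ∸ 4 * k
    s+4k≡n+4 : s + 4 * k ≡ n + 4
    s+4k≡n+4 = ℕₚ.m∸n+n≡m 4k≤n+4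
    sq′ : 2 * (n + 4) ≤ s * s
    sq′ = subst (2 * (n + 4) ≤_) (cong (s *_) (ℕₚ.*-identityʳ s)) sq
    4k≤n : 4 * k ≤ n
    4k≤n = ℕₚ.+-cancelʳ-≤ 4 (4 * k) n (begin
      4 * k + 4  ≡⟨ ℕₚ.+-comm (4 * k) 4 ⟩
      4 + 4 * k  ≤⟨ ℕₚ.+-monoˡ-≤ (4 * k) (large-square-root n s 4≤n sq′) ⟩
      s + 4 * k  ≡⟨ s+4k≡n+4 ⟩
      n + 4      ∎)
    u = n ∸ 4 * k
    n≡ : u + 4 * k ≡ n
    n≡ = ℕₚ.m∸n+n≡m 4k≤n
    s≡u+4 : s ≡ u + 4
    s≡u+4 = ℕₚ.+-cancelʳ-≡ (4 * k) s (u + 4) (begin-equality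
      s + 4 * k      ≡⟨ s+4k≡n+4 ⟩
      n + 4          ≡⟨ cong (_+ 4) (sym n≡) ⟩
      u + 4 * k + 4  ≡⟨ exchange u (4 * k) ⟩
      u + 4 + 4 * k  ∎)
      where
      exchange : ∀ a b → a + b + 4 ≡ a + 4 + b
      exchange = ℕ-Solver.solve-∀
    below : BelowTau u k
    below = ℕₚ.+-cancelʳ-≤ (2 * u + 8) (8 * k) (u * u + 6 * u + 8) (begin
      8 * k + (2 * u + 8)          ≡⟨ expand₁ u k ⟩
      2 * (u + 4 * k + 4)          ≡⟨ cong (λ m → 2 * (m + 4)) n≡ ⟩
      2 * (n + 4)                  ≤⟨ sq′ ⟩
      s * s                        ≡⟨ cong (λ t → t * t) s≡u+4 ⟩
      (u + 4) * (u + 4)            ≡⟨ expand₂ u ⟩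
      u * u + 6 * u + 8 + (2 * u + 8) ∎)
      where
      expand₁ : ∀ u k → 8 * k + (2 * u + 8) ≡ 2 * (u + 4 * k + 4)
      expand₁ = ℕ-Solver.solve-∀
      expand₂ : ∀ u → (u + 4) * (u + 4) ≡ u * u + 6 * u + 8 + (2 * u + 8)
      expand₂ = ℕ-Solver.solve-∀

  ≤⇒∃-complement : ∀ {i d n} → i + d ≤ n → ∃ λ y → i + (d + y) ≡ n
  ≤⇒∃-complement {i} {d} h with ℕₚ.m≤n⇒∃[o]m+o≡n h
  ... | y , eq = y , trans (sym (ℕₚ.+-assoc i d y)) eq

open import Data.Nat using (ℕ; _≤_; _<_; _+_; _*_; _∸_; _^_)
open import Data.Integer using (+_; ∣_∣) renaming (_≤_ to _≤ℤ_)
open import Data.Product using (_×_)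

+≤ℤ-pos : ∀ {a b g} → g ≡ + b → a ≤ b → + a ≤ℤ g
+≤ℤ-pos {a} g≡ a≤b = subst (+ a ≤ℤ_) (sym g≡) (ℤ.+≤+ a≤b)

K-bounded-by-K₀ : ∀ n k i → i ≤ n → + ∣ K n k i ∣ ≤ℤ K n k 0
K-bounded-by-K₀ n k i i≤n = +≤ℤ-pos (trans (K≡kraw n k 0) (kraw-zeroˡ n k)) (begin
  ∣ K n k i ∣              ≡⟨ cong ∣_∣ (K≡kraw n k i) ⟩
  ∣ kraw i (n ∸ i) k ∣     ≤⟨ ∣kraw∣≤binomial k i (n ∸ i) ⟩
  binomial (i + (n ∸ i)) k ≡⟨ cong (λ m → binomial m k) (ℕₚ.m+[n∸m]≡n i≤n) ⟩
  binomial n k             ∎)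
  where open ℕₚ.≤-Reasoning

K-bounded-by-K₁ : ∀ n k i → 2 * k + 1 ≤ n → 1 ≤ i → i + 1 ≤ n → + ∣ K n k i ∣ ≤ℤ K n k 1
K-bounded-by-K₁ n k zero    _      ()
K-bounded-by-K₁ n k (suc x) 2k+1≤n _ i+1≤n with ≤⇒∃-complement {suc x} {1} i+1≤n
... | y , refl = +≤ℤ-pos (trans (K≡kraw n k 1) (kraw-1-nonneg k (x + suc y) k+k<n)) (begin
  ∣ K n k (suc x) ∣                ≡⟨ cong ∣_∣ (K≡kraw-complement (suc x) (suc y) k) ⟩
  ∣ kraw (suc x) (suc y) k ∣       ≤⟨ dominated₁ k x y k+k<n ⟩
  ∣ kraw 1 (x + suc y) k ∣         ∎)
  where
  open ℕₚ.≤-Reasoning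
  k+k<n : k + k < n
  k+k<n = subst (_≤ n) (regroup k) 2k+1≤n
    where
    regroup : ∀ k → 2 * k + 1 ≡ suc (k + k)
    regroup = ℕ-Solver.solve-∀

K-bounded-by-K₂ : ∀ n k i → 4 * k ≤ n + 4 → 2 * (n + 4) ≤ ((n + 4) ∸ 4 * k) ^ 2 → 2 ≤ i → i + 2 ≤ n →
                  + ∣ K n k i ∣ ≤ℤ K n k 2
K-bounded-by-K₂ n k zero          _      _ ()
K-bounded-by-K₂ n k (suc zero)    _      _ (s≤s ())
K-bounded-by-K₂ n k (suc (suc x)) 4k≤n+4 τ _ i+2≤n with ≤⇒∃-complement {2 + x} {2} i+2≤n
... | y , refl with k≤τ⇒BelowTau n k (ℕₚ.+-monoʳ-≤ 2 (ℕₚ.≤-trans (ℕₚ.m≤m+n 2 y) (ℕₚ.m≤n+m (2 + y) x))) 4k≤n+4 τ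
... | u , n≡ , below = +≤ℤ-pos (trans (K≡kraw n k 2) (proj₁ (kraw-2-closedℕ k u (x + (2 + y)) n≡))) (begin
  ∣ K n k (2 + x) ∣              ≡⟨ cong ∣_∣ (K≡kraw-complement (2 + x) (2 + y) k) ⟩
  ∣ kraw (2 + x) (2 + y) k ∣     ≤⟨ dominated₂ k u below x y n≡ ⟩
  ∣ kraw 2 (x + (2 + y)) k ∣     ∎)
  where open ℕₚ.≤-Reasoning

lemma7 : (n : ℕ) → 1 ≤ n →
    ((k i : ℕ) → k ≤ n → i ≤ n → + ∣ K n k i ∣ ≤ℤ K n k 0)
    × ((k i : ℕ) → 2 * k + 1 ≤ n → 1 ≤ i → i + 1 ≤ n → + ∣ K n k i ∣ ≤ℤ K n k 1)
    × ((k i : ℕ) → 4 * k ≤ n + 4 → 2 * (n + 4) ≤ ((n + 4) ∸ 4 * k) ^ 2 →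
         2 ≤ i → i + 2 ≤ n → + ∣ K n k i ∣ ≤ℤ K n k 2)
lemma7 n _ = (λ k i _ → K-bounded-by-K₀ n k i) , K-bounded-by-K₁ n , K-bounded-by-K₂ n
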